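{- Let $G=(V,E)$ be a computation graph with $n=|V|$ vertices and let $M$ be the fast-memory size. For a vertex $u$ let $d_{out}(u)$ denote its out-degree, and for $S\subseteq V$ let $\partial S=\{(u,v)\in E : (u\in S, v\notin S)\text{ or } (v\in S, u\notin S)\}$. For an evaluation order $X$ (a topological ordering of $G$), let $\mathcal{P}_X$ be the set of partitions $P$ of $V$ into disjoint nonempty subsets such that each $S\in P$ consists of vertices that are consecutive in the order $X$. Then the optimal I/O satisfies $$J^*_G \;\geq\; \min_{X \in \mathcal{O}_G}\ \max_{P \in \mathcal{P}_X} \left(\sum_{S \in P}\ \sum_{(u,v) \in \partial S} \frac{1}{d_{out}(u)}\right) - 2M |P|,$$ where $\mathcal{O}_G$ is the set of topological orderings of $G$.
   Context: A computation graph is a finite directed acyclic graph $G=(V,E)$: each vertex is an operation producing a single element, and an edge $(u,v)$ means $u$ is an operand of $v$; sources are inputs and sinks are outputs. Memory model: a single processor with a fast memory holding at most $M$ elements and an unbounded slow memory. Each vertex is evaluated exactly once (no recomputation), in an order that is a topological ordering of $G$; when a vertex is evaluated, all its parents must be present in fast memory, and its result is placed in fast memory. The eviction policy is unconstrained, but if a value is evicted from fast memory while still needed later, it must first be written to slow memory. One I/O is counted for each element written from fast to slow memory or read from slow to fast memory. Only non-trivial I/O is counted: inputs may be placed into fast memory directly at no cost and outputs are reported at no cost as they are computed (but an input evicted while still needed must be written to slow memory). For an evaluation order $X$, $J_G(X)$ denotes the number of such I/Os incurred (with the best memory management), and $J_G^*=\inf_{X\in\mathcal{O}_G} J_G(X)$.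 -}

module Defs where

open import Data.Nat as ℕ using (ℕ; zero; suc)
open import Data.Bool using (Bool; true; false; if_then_else_; _xor_)
open import Data.Fin using (Fin)
open import Data.Fin.Properties using (_≟_)
open import Data.Fin.Subset using (Subset; ⁅_⁆; _∪_; _-_; ∣_∣) renaming (⊥ to ∅; _∈_ to _∈ₛ_)
open import Data.List using (List; []; _∷_; map; length; concat; allFin; foldr)
open import Data.Bool.ListAction using (any)
open import Data.List.Membership.Propositional using (_∈_)
open import Data.List.Relation.Unary.All using (All)
open import Data.List.Relation.Unary.Unique.Propositional using (Unique)
open import Data.Integer using (+_)
open import Data.Rational using (ℚ; 0ℚ; _/_; _≤_) renaming (_+_ to _+ℚ_; _-_ to _-ℚ_)
open import Data.Product using (Σ; _×_)
open import Relation.Binary.PropositionalEquality using (_≡_; _≢_)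
open import Relation.Nullary using (¬_; does)

-- Computation graphs: vertices Fin n; the edge (u , v) is present iff
-- E u v ≡ true (u is an operand of v).

record Graph (n : ℕ) : Set where
  field
    E : Fin n → Fin n → Bool
open Graph public

data Path {n : ℕ} (G : Graph n) : Fin n → Fin n → Set where
  edge : ∀ {u v} → E G u v ≡ true → Path G u v
  cons : ∀ {u w v} → E G u w ≡ true → Path G w v → Path G u v

Acyclic : ∀ {n} → Graph n → Set
Acyclic G = ∀ v → ¬ Path G v v

data Before {n : ℕ} (u v : Fin n) : List (Fin n) → Set where
  here  : ∀ {xs} → v ∈ xs → Before u v (u ∷ xs)
  there : ∀ {x xs} → Before u v xs → Before u v (x ∷ xs)

record TopOrder {n : ℕ} (G : Graph n) (X : List (Fin n)) : Set where
  field
    unique   : Unique X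
    complete : ∀ v → v ∈ X
    respects : ∀ u v → E G u v ≡ true → Before u v X

-- A schedule is a list of operations on a fast memory
-- (capacity M) and an unbounded slow memory, both initially empty.
--   compute v : evaluate v; all parents must be in fast memory; the result
--               is placed into fast memory (inputs = sources thus enter fast
--               memory at no cost).
--   store v   : write v from fast to slow memory   (1 I/O)
--   load v    : read v from slow to fast memory    (1 I/O)
--   evict v   : drop v from fast memory (free).  A value evicted without
--               having been stored can never be brought back, so a value
--               still needed later must be stored first.  Outputs need no I/O.

data Op (n : ℕ) : Set where
  compute store load evict : Fin n → Op n

record State (n : ℕ) : Set where
  constructor ⟨_,_⟩
  field
    fast slow : Subset n

data Step {n : ℕ} (G : Graph n) (M : ℕ) : State n → Op n → State n → Set where
  compute : ∀ {f s v} → (∀ u → E G u v ≡ true → u ∈ₛ f) →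
            ∣ f ∪ ⁅ v ⁆ ∣ ℕ.≤ M →
            Step G M ⟨ f , s ⟩ (compute v) ⟨ f ∪ ⁅ v ⁆ , s ⟩
  store   : ∀ {f s v} → v ∈ₛ f →
            Step G M ⟨ f , s ⟩ (store v) ⟨ f , s ∪ ⁅ v ⁆ ⟩
  load    : ∀ {f s v} → v ∈ₛ s → ∣ f ∪ ⁅ v ⁆ ∣ ℕ.≤ M →
            Step G M ⟨ f , s ⟩ (load v) ⟨ f ∪ ⁅ v ⁆ , s ⟩
  evict   : ∀ {f s v} →
            Step G M ⟨ f , s ⟩ (evict v) ⟨ f - v , s ⟩

data Run {n : ℕ} (G : Graph n) (M : ℕ) : State n → List (Op n) → Set where
  done : ∀ {st} → Run G M st []
  step : ∀ {st o st' os} → Step G M st o st' → Run G M st' os → Run G M st (o ∷ os)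

computed : ∀ {n} → List (Op n) → List (Fin n)
computed []              = []
computed (compute v ∷ s) = v ∷ computed s
computed (_ ∷ s)         = computed s

cost : ∀ {n} → List (Op n) → ℕ
cost []            = 0
cost (store _ ∷ s) = suc (cost s)
cost (load _ ∷ s)  = suc (cost s)
cost (_ ∷ s)       = cost s

ValidSchedule : ∀ {n} → Graph n → ℕ → List (Fin n) → List (Op n) → Set
ValidSchedule G M X s = Run G M ⟨ ∅ , ∅ ⟩ s × computed s ≡ X

ConsecPartition : ∀ {n} → List (Fin n) → List (List (Fin n)) → Set
ConsecPartition X P = All (λ S → S ≢ []) P × concat P ≡ X

sumℕ : List ℕ → ℕ
sumℕ = foldr ℕ._+_ 0

sumℚ : List ℚ → ℚ
sumℚ = foldr _+ℚ_ 0ℚ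

bit : Bool → ℕ
bit true  = 1
bit false = 0

dout : ∀ {n} → Graph n → Fin n → ℕ
dout {n} G u = sumℕ (map (λ v → bit (E G u v)) (allFin n))

-- 1/d ; only ever used for d = d_out(u) ≥ 1 (u has an out-edge)
inv : ℕ → ℚ
inv zero    = 0ℚ
inv (suc d) = + 1 / suc d

member : ∀ {n} → Fin n → List (Fin n) → Bool
member v S = any (λ w → does (v ≟ w)) S

inBoundary : ∀ {n} → Graph n → List (Fin n) → Fin n → Fin n → Bool
inBoundary G S u v = if E G u v then member u S xor member v S else false

boundaryWeight : ∀ {n} → Graph n → List (Fin n) → ℚ
boundaryWeight {n} G S =
  sumℚ (map (λ u → sumℚ (map (λ v → if inBoundary G S u v then inv (dout G u) else 0ℚ)
                            (allFin n)))
            (allFin n))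

partitionValue : ∀ {n} → Graph n → ℕ → List (List (Fin n)) → ℚ
partitionValue G M P =
  sumℚ (map (boundaryWeight G) P) -ℚ (+ (2 ℕ.* M ℕ.* length P) / 1)

-- "min_{X ∈ 𝒪_G} max_{P ∈ 𝒫_X} value(P) ≤ c", unfolded: some evaluation
-- order X has every consecutive partition of value at most c.

MinMax≤ : ∀ {n} → Graph n → ℕ → ℚ → Set
MinMax≤ {n} G M c =
  Σ (List (Fin n)) λ X → TopOrder G X ×
    (∀ P → ConsecPartition X P → partitionValue G M P ≤ c)

-- "J*_G ≥ m" where m = min max … : every valid schedule, for every
-- evaluation order, has cost at least m.
OptIO≥MinMax : ∀ {n} → Graph n → ℕ → Set
OptIO≥MinMax {n} G M =
  ∀ (X : List (Fin n)) → TopOrder G X →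
  ∀ (s : List (Op n)) → ValidSchedule G M X s →
  MinMax≤ G M (+ cost s / 1)

-- Fix any valid schedule and cut it at the boundaries of the blocks of a
-- consecutive partition P.  If an edge (u , v) crosses the boundary of a block
-- S, then u must be available when v is evaluated, and one of the two is
-- evaluated inside the window of S and the other outside.  Hence u is in fast
-- memory when the window opens or when it closes, or it is loaded or stored
-- inside the window.  So at most 2M + (I/O of the window) vertices send an edge
-- across ∂S, and each such u contributes at most d_out(u) · 1/d_out(u) = 1 to
-- the boundary weight of S.  Summing over the blocks bounds the value of every
-- partition by the cost of the schedule, and the order of the schedule itself
-- witnesses the minimum.
module Submission where

open import Algebra.Properties.AbelianGroup using (xyx⁻¹≈y)
open import Data.Bool using (Bool; true; false; if_then_else_; T)
open import Data.Bool.ListAction using (any)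
open import Data.Bool.Properties using (T-≡)
open import Data.Empty using (⊥; ⊥-elim)
open import Data.Fin using (Fin; zero; suc)
open import Data.Fin.Properties using (_≟_)
open import Data.Fin.Subset using (Subset; ⁅_⁆; _∪_; _⊆_; ∣_∣)
  renaming (⊥ to ∅; _-_ to _-ₛ_; _∈_ to _∈ₛ_; _∉_ to _∉ₛ_)
open import Data.Fin.Subset.Properties
  using (_∈?_; x∈p∪q⁺; x∈p∪q⁻; x≢y⇒x∉⁅y⁆; ∣⁅x⁆∣≡1; ∣⊥∣≡0; ∉⊥; p─q⊆p; ∣p─q∣≤∣p∣; ∣p∣≤∣x∷p∣; p⊆q⇒∣p∣≤∣q∣)
import Data.Integer as ℤ
import Data.Integer.Properties as ℤP
open import Data.List using (List; []; _∷_; map; allFin; concat; length; _++_)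
import Data.List as List
open import Data.List.Membership.Propositional using (_∈_; _∉_)
open import Data.List.Membership.Propositional.Properties using (∈-++⁺ˡ; ∈-++⁺ʳ; ∈-++⁻)
import Data.List.Properties as ListP
open import Data.List.Relation.Unary.All as All using ()
open import Data.List.Relation.Unary.AllPairs using (_∷_)
open import Data.List.Relation.Unary.Any using (here; there; satisfied)
open import Data.List.Relation.Unary.Any.Properties using (any⁻)
open import Data.List.Relation.Unary.Unique.Propositional using (Unique)
open import Data.Nat as ℕ using (ℕ; zero; suc; z≤n; s≤s)
open import Data.Nat.Coprimality using (1-coprimeTo)
import Data.Nat.Coprimality as Coprime
import Data.Nat.Properties as ℕP
open import Data.Nat.Tactic.RingSolver using (solve-∀)
open import Data.Product using (∃; _×_; _,_; proj₁; proj₂)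
open import Data.Rational using (ℚ; 0ℚ; 1ℚ; mkℚ; _/_; _≤_; _+_; _-_; -_; _*_)
import Data.Rational.Properties as ℚP
import Data.Rational.Unnormalised as ℚᵘ
import Data.Rational.Unnormalised.Properties as ℚᵘP
open import Data.Sum using (_⊎_; inj₁; inj₂; [_,_])
import Data.Vec as Vec
open import Data.Vec.Properties using ([]=⇒lookup; lookup∘tabulate)
open import Function using (_∘_; id)
open import Function.Bundles using (Equivalence)
open import Relation.Binary.PropositionalEquality hiding ([_])
open import Relation.Nullary using (yes; no)

open import Defs

fromℕ : ℕ → ℚ
fromℕ k = mkℚ (ℤ.+ k) 0 (Coprime.sym (1-coprimeTo k))

/1≡fromℕ : ∀ k → ℤ.+ k / 1 ≡ fromℕ k
/1≡fromℕ k = ℚP.normalize-coprime (Coprime.sym (1-coprimeTo k))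

fromℕ-+ : ∀ m n → fromℕ (m ℕ.+ n) ≡ fromℕ m + fromℕ n
fromℕ-+ m n = ℚP.toℚᵘ-injective
  (ℚᵘP.≃-trans (ℚᵘ.*≡* numerators) (ℚᵘP.≃-sym (ℚP.toℚᵘ-homo-+ (fromℕ m) (fromℕ n))))
  where
  numerators : ℤ.+ (m ℕ.+ n) ℤ.* ℤ.+ 1 ≡ (ℤ.+ m ℤ.* ℤ.+ 1 ℤ.+ ℤ.+ n ℤ.* ℤ.+ 1) ℤ.* ℤ.+ 1
  numerators = trans (ℤP.*-identityʳ _)
    (sym (trans (ℤP.*-identityʳ _) (cong₂ ℤ._+_ (ℤP.*-identityʳ (ℤ.+ m)) (ℤP.*-identityʳ (ℤ.+ n)))))

fromℕ-mono-≤ : ∀ {m n} → m ℕ.≤ n → fromℕ m ≤ fromℕ n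
fromℕ-mono-≤ {m} {n} m≤n = ℚP.toℚᵘ-cancel-≤ (ℚᵘ.*≤*
  (subst₂ ℤ._≤_ (sym (ℤP.*-identityʳ (ℤ.+ m))) (sym (ℤP.*-identityʳ (ℤ.+ n))) (ℤ.+≤+ m≤n)))

inv-nonNeg : ∀ d → 0ℚ ≤ inv d
inv-nonNeg zero    = ℚP.≤-refl
inv-nonNeg (suc d) = ℚP.nonNegative⁻¹ _ {{ℚP.normalize-nonNeg 1 (suc d)}}

fromℕ*inv≤1 : ∀ d → fromℕ d * inv d ≤ 1ℚ
fromℕ*inv≤1 zero    = ℚP.≤ᵇ⇒≤ _
fromℕ*inv≤1 (suc d) = ℚP.≤-reflexive
  (trans (cong (fromℕ (suc d) *_) (ℚP.normalize-coprime (1-coprimeTo (suc d))))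
         (ℚP.*-inverseʳ (fromℕ (suc d))))

-+-cancel : ∀ (p q r : ℚ) → p ≤ q + r → p - q ≤ r
-+-cancel p q r p≤q+r =
  ℚP.≤-trans (ℚP.+-monoˡ-≤ (- q) p≤q+r) (ℚP.≤-reflexive (xyx⁻¹≈y ℚP.+-0-abelianGroup q r))

module _ {A : Set} where

  sumℚ-mono-≤ : ∀ {f g : A → ℚ} (xs : List A) → (∀ x → f x ≤ g x) →
                sumℚ (map f xs) ≤ sumℚ (map g xs)
  sumℚ-mono-≤ []       f≤g = ℚP.≤-refl
  sumℚ-mono-≤ (x ∷ xs) f≤g = ℚP.+-mono-≤ (f≤g x) (sumℚ-mono-≤ xs f≤g)

  sumℚ-fromℕ : ∀ (f : A → ℕ) xs → sumℚ (map (fromℕ ∘ f) xs) ≡ fromℕ (sumℕ (map f xs))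
  sumℚ-fromℕ f []       = refl
  sumℚ-fromℕ f (x ∷ xs) =
    trans (cong (fromℕ (f x) +_) (sumℚ-fromℕ f xs)) (sym (fromℕ-+ (f x) _))

  sumℚ-if : ∀ (c : A → Bool) q xs →
            sumℚ (map (λ x → if c x then q else 0ℚ) xs) ≡ fromℕ (sumℕ (map (bit ∘ c) xs)) * q
  sumℚ-if c q []       = sym (ℚP.*-zeroˡ q)
  sumℚ-if c q (x ∷ xs) with c x
  ... | false = trans (ℚP.+-identityˡ _) (sumℚ-if c q xs)
  ... | true  = begin
    q + sumℚ (map (λ x → if c x then q else 0ℚ) xs) ≡⟨ cong (q +_) (sumℚ-if c q xs) ⟩
    q + fromℕ k * q        ≡⟨ cong (_+ fromℕ k * q) (ℚP.*-identityˡ q) ⟨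
    1ℚ * q + fromℕ k * q   ≡⟨ ℚP.*-distribʳ-+ q 1ℚ (fromℕ k) ⟨
    (1ℚ + fromℕ k) * q     ≡⟨ cong (_* q) (fromℕ-+ 1 k) ⟨
    fromℕ (suc k) * q      ∎
    where
    open ≡-Reasoning
    k : ℕ
    k = sumℕ (map (bit ∘ c) xs)

  sumℚ-if-none : ∀ (c : A → Bool) q xs → any c xs ≡ false →
                 sumℚ (map (λ x → if c x then q else 0ℚ) xs) ≡ 0ℚ
  sumℚ-if-none c q []       _ = refl
  sumℚ-if-none c q (x ∷ xs) none with c x
  ... | false = trans (ℚP.+-identityˡ _) (sumℚ-if-none c q xs none)

if-mono-≤ : ∀ {b c : Bool} {q : ℚ} → 0ℚ ≤ q → (b ≡ true → c ≡ true) →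
            (if b then q else 0ℚ) ≤ (if c then q else 0ℚ)
if-mono-≤ {false} {false} _   _   = ℚP.≤-refl
if-mono-≤ {false} {true}  0≤q _   = 0≤q
if-mono-≤ {true}  {true}  _   _   = ℚP.≤-refl
if-mono-≤ {true}  {false} _   b⇒c with b⇒c refl
... | ()

sumℕ-bit-tabulate : ∀ {n} (c : Fin n → Bool) → sumℕ (List.tabulate (bit ∘ c)) ≡ ∣ Vec.tabulate c ∣
sumℕ-bit-tabulate {zero}  c = refl
sumℕ-bit-tabulate {suc n} c with c zero
... | true  = cong suc (sumℕ-bit-tabulate (c ∘ suc))
... | false = sumℕ-bit-tabulate (c ∘ suc)

sumℕ-bit≡∣tabulate∣ : ∀ {n} (c : Fin n → Bool) → sumℕ (map (bit ∘ c) (allFin n)) ≡ ∣ Vec.tabulate c ∣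
sumℕ-bit≡∣tabulate∣ c = trans (cong sumℕ (ListP.map-tabulate id (bit ∘ c))) (sumℕ-bit-tabulate c)

∣p∪q∣≤∣p∣+∣q∣ : ∀ {n} (p q : Subset n) → ∣ p ∪ q ∣ ℕ.≤ ∣ p ∣ ℕ.+ ∣ q ∣
∣p∪q∣≤∣p∣+∣q∣ Vec.[]          Vec.[]          = z≤n
∣p∪q∣≤∣p∣+∣q∣ (true Vec.∷ p)  (x Vec.∷ q)     =
  s≤s (ℕP.≤-trans (∣p∪q∣≤∣p∣+∣q∣ p q) (ℕP.+-monoʳ-≤ ∣ p ∣ (∣p∣≤∣x∷p∣ x q)))
∣p∪q∣≤∣p∣+∣q∣ (false Vec.∷ p) (true Vec.∷ q)  =
  ℕP.≤-trans (s≤s (∣p∪q∣≤∣p∣+∣q∣ p q)) (ℕP.≤-reflexive (sym (ℕP.+-suc ∣ p ∣ ∣ q ∣)))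
∣p∪q∣≤∣p∣+∣q∣ (false Vec.∷ p) (false Vec.∷ q) = ∣p∪q∣≤∣p∣+∣q∣ p q

module _ {n : ℕ} where

  ∉∪⁺ : ∀ {x : Fin n} {p q} → x ∉ₛ p → x ∉ₛ q → x ∉ₛ p ∪ q
  ∉∪⁺ {p = p} {q} x∉p x∉q x∈p∪q = [ x∉p , x∉q ] (x∈p∪q⁻ p q x∈p∪q)

  ∉∪⁻ˡ : ∀ {x : Fin n} {p q} → x ∉ₛ p ∪ q → x ∉ₛ p
  ∉∪⁻ˡ x∉p∪q = x∉p∪q ∘ x∈p∪q⁺ ∘ inj₁

  ∉∪⁻ʳ : ∀ {x : Fin n} {p q} → x ∉ₛ p ∪ q → x ∉ₛ q
  ∉∪⁻ʳ x∉p∪q = x∉p∪q ∘ x∈p∪q⁺ ∘ inj₂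

  ∉-⁺ : ∀ {x y : Fin n} {p} → x ∉ₛ p → x ∉ₛ p -ₛ y
  ∉-⁺ {p = p} x∉p = x∉p ∘ p─q⊆p p _

  ∣⁅x⁆∪p∣≤1+∣p∣ : ∀ (x : Fin n) p → ∣ ⁅ x ⁆ ∪ p ∣ ℕ.≤ suc ∣ p ∣
  ∣⁅x⁆∪p∣≤1+∣p∣ x p = ℕP.≤-trans (∣p∪q∣≤∣p∣+∣q∣ ⁅ x ⁆ p) (ℕP.≤-reflexive (cong (ℕ._+ ∣ p ∣) (∣⁅x⁆∣≡1 x)))

  member⇒∈ : ∀ {v : Fin n} S → member v S ≡ true → v ∈ S
  member⇒∈ {v} (x ∷ S) h with v ≟ x
  ... | yes v≡x = here v≡x
  ... | no  _   = there (member⇒∈ S h)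

  ¬member⇒∉ : ∀ {v : Fin n} S → member v S ≡ false → v ∉ S
  ¬member⇒∉ {v} (x ∷ S) h v∈ with v ≟ x
  ¬member⇒∉ {v} (x ∷ S) () v∈          | yes _
  ¬member⇒∉ {v} (x ∷ S) h  (here v≡x)  | no v≢x = v≢x v≡x
  ¬member⇒∉ {v} (x ∷ S) h  (there v∈S) | no _   = ¬member⇒∉ S h v∈S

-- Boundary sources

Crosses : ∀ {n} → List (Fin n) → Fin n → Fin n → Set
Crosses S u v = (u ∈ S × v ∉ S) ⊎ (u ∉ S × v ∈ S)

inBoundary⇒crossing : ∀ {n} (G : Graph n) S u v → inBoundary G S u v ≡ true →
                      E G u v ≡ true × Crosses S u v
inBoundary⇒crossing G S u v h with E G u v | member u S in u∈? | member v S in v∈?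
inBoundary⇒crossing G S u v () | false | _     | _
inBoundary⇒crossing G S u v () | true  | true  | true
inBoundary⇒crossing G S u v h  | true  | true  | false = refl , inj₁ (member⇒∈ S u∈? , ¬member⇒∉ S v∈?)
inBoundary⇒crossing G S u v h  | true  | false | true  = refl , inj₂ (¬member⇒∉ S u∈? , member⇒∈ S v∈?)
inBoundary⇒crossing G S u v () | true  | false | false

hasCrossingEdge : ∀ {n} → Graph n → List (Fin n) → Fin n → Bool
hasCrossingEdge {n} G S u = any (inBoundary G S u) (allFin n)

boundarySources : ∀ {n} → Graph n → List (Fin n) → Subset n
boundarySources G S = Vec.tabulate (hasCrossingEdge G S)

∈boundarySources⇒crossing : ∀ {n} (G : Graph n) S {u} → u ∈ₛ boundarySources G S →
                            ∃ λ v → E G u v ≡ true × Crosses S u v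
∈boundarySources⇒crossing G S {u} u∈ =
  let v , crosses = satisfied (any⁻ (inBoundary G S u) (allFin _) hasEdge)
  in  v , inBoundary⇒crossing G S u v (Equivalence.to T-≡ crosses)
  where
  hasEdge : T (hasCrossingEdge G S u)
  hasEdge = Equivalence.from T-≡
    (trans (sym (lookup∘tabulate (hasCrossingEdge G S) u)) ([]=⇒lookup u∈))

outflow≤1 : ∀ {n} (G : Graph n) S u →
  sumℚ (map (λ v → if inBoundary G S u v then inv (dout G u) else 0ℚ) (allFin n))
    ≤ (if hasCrossingEdge G S u then 1ℚ else 0ℚ)
outflow≤1 {n} G S u with hasCrossingEdge G S u in none
... | false = ℚP.≤-reflexive (sumℚ-if-none (inBoundary G S u) (inv (dout G u)) (allFin n) none)
... | true  = begin
  sumℚ (map (λ v → if inBoundary G S u v then inv (dout G u) else 0ℚ) (allFin n))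
    ≤⟨ sumℚ-mono-≤ (allFin n) (λ v → if-mono-≤ (inv-nonNeg (dout G u)) (proj₁ ∘ inBoundary⇒crossing G S u v)) ⟩
  sumℚ (map (λ v → if E G u v then inv (dout G u) else 0ℚ) (allFin n))
    ≡⟨ sumℚ-if (E G u) (inv (dout G u)) (allFin n) ⟩
  fromℕ (dout G u) * inv (dout G u)
    ≤⟨ fromℕ*inv≤1 (dout G u) ⟩
  1ℚ ∎
  where open ℚP.≤-Reasoning

boundaryWeight≤∣boundarySources∣ : ∀ {n} (G : Graph n) S →
                                   boundaryWeight G S ≤ fromℕ ∣ boundarySources G S ∣
boundaryWeight≤∣boundarySources∣ {n} G S = begin
  boundaryWeight G S
    ≤⟨ sumℚ-mono-≤ (allFin n) (outflow≤1 G S) ⟩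
  sumℚ (map (λ u → if hasCrossingEdge G S u then 1ℚ else 0ℚ) (allFin n))
    ≡⟨ sumℚ-if (hasCrossingEdge G S) 1ℚ (allFin n) ⟩
  fromℕ (sumℕ (map (bit ∘ hasCrossingEdge G S) (allFin n))) * 1ℚ
    ≡⟨ ℚP.*-identityʳ _ ⟩
  fromℕ (sumℕ (map (bit ∘ hasCrossingEdge G S) (allFin n)))
    ≡⟨ cong fromℕ (sumℕ-bit≡∣tabulate∣ (hasCrossingEdge G S)) ⟩
  fromℕ ∣ boundarySources G S ∣ ∎
  where open ℚP.≤-Reasoning

Enumerates : ∀ {n} → List (Fin n) → Set
Enumerates {n} xs = Unique xs × (∀ (v : Fin n) → v ∈ xs)

module _ {n : ℕ} where

  Unique-++⇒∉ʳ : ∀ (xs : List (Fin n)) {ys x} → Unique (xs ++ ys) → x ∈ xs → x ∉ ys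
  Unique-++⇒∉ʳ (_ ∷ xs) (x∉ ∷ _)  (here refl) x∈ys = All.lookup x∉ (∈-++⁺ʳ xs x∈ys) refl
  Unique-++⇒∉ʳ (_ ∷ xs) (_ ∷ uniq) (there x∈xs) = Unique-++⇒∉ʳ xs uniq x∈xs

  Unique-++⁻ʳ : ∀ (xs : List (Fin n)) {ys} → Unique (xs ++ ys) → Unique ys
  Unique-++⁻ʳ []       uniq       = uniq
  Unique-++⁻ʳ (_ ∷ xs) (_ ∷ uniq) = Unique-++⁻ʳ xs uniq

  module _ (xs : List (Fin n)) {ys zs : List (Fin n)} (enum : Enumerates (xs ++ ys ++ zs)) where

    ∈middle⇒∉outer : ∀ {x} → x ∈ ys → x ∉ xs × x ∉ zs
    ∈middle⇒∉outer x∈ys =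
        (λ x∈xs → Unique-++⇒∉ʳ xs (proj₁ enum) x∈xs (∈-++⁺ˡ x∈ys))
      , Unique-++⇒∉ʳ ys (Unique-++⁻ʳ xs (proj₁ enum)) x∈ys

    ∉middle⇒∈outer : ∀ {x} → x ∉ ys → x ∈ xs ⊎ x ∈ zs
    ∉middle⇒∈outer {x} x∉ys with ∈-++⁻ xs (proj₂ enum x)
    ... | inj₁ x∈xs = inj₁ x∈xs
    ... | inj₂ x∈ys++zs with ∈-++⁻ ys x∈ys++zs
    ...   | inj₁ x∈ys = ⊥-elim (x∉ys x∈ys)
    ...   | inj₂ x∈zs = inj₂ x∈zs

-- Schedules and their executions

computed-++ : ∀ {n} (s t : List (Op n)) → computed (s ++ t) ≡ computed s ++ computed t
computed-++ []              t = refl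
computed-++ (compute v ∷ s) t = cong (v ∷_) (computed-++ s t)
computed-++ (store _ ∷ s)   t = computed-++ s t
computed-++ (load _ ∷ s)    t = computed-++ s t
computed-++ (evict _ ∷ s)   t = computed-++ s t

cost-++ : ∀ {n} (s t : List (Op n)) → cost (s ++ t) ≡ cost s ℕ.+ cost t
cost-++ []              t = refl
cost-++ (compute _ ∷ s) t = cost-++ s t
cost-++ (store _ ∷ s)   t = cong suc (cost-++ s t)
cost-++ (load _ ∷ s)    t = cong suc (cost-++ s t)
cost-++ (evict _ ∷ s)   t = cost-++ s t

split-computed : ∀ {n} (s : List (Op n)) xs ys → computed s ≡ xs ++ ys →
  ∃ λ w → ∃ λ r → s ≡ w ++ r × computed w ≡ xs × computed r ≡ ys
split-computed s               []       ys eq = [] , s , refl , refl , eq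
split-computed (compute v ∷ s) (x ∷ xs) ys eq
  with w , r , refl , refl , eq′ ← split-computed s xs ys (ListP.∷-injectiveʳ eq)
  = compute v ∷ w , r , refl , cong (_∷ computed w) (ListP.∷-injectiveˡ eq) , eq′
split-computed (store v ∷ s)   (x ∷ xs) ys eq
  with w , r , refl , eqˡ , eqʳ ← split-computed s (x ∷ xs) ys eq
  = store v ∷ w , r , refl , eqˡ , eqʳ
split-computed (load v ∷ s)    (x ∷ xs) ys eq
  with w , r , refl , eqˡ , eqʳ ← split-computed s (x ∷ xs) ys eq
  = load v ∷ w , r , refl , eqˡ , eqʳ
split-computed (evict v ∷ s)   (x ∷ xs) ys eq
  with w , r , refl , eqˡ , eqʳ ← split-computed s (x ∷ xs) ys eq
  = evict v ∷ w , r , refl , eqˡ , eqʳ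

touched : ∀ {n} → List (Op n) → Subset n
touched []              = ∅
touched (store v ∷ s)   = ⁅ v ⁆ ∪ touched s
touched (load v ∷ s)    = ⁅ v ⁆ ∪ touched s
touched (compute _ ∷ s) = touched s
touched (evict _ ∷ s)   = touched s

∣touched∣≤cost : ∀ {n} (s : List (Op n)) → ∣ touched s ∣ ℕ.≤ cost s
∣touched∣≤cost {n} []          = ℕP.≤-reflexive (∣⊥∣≡0 n)
∣touched∣≤cost (store v ∷ s)   = ℕP.≤-trans (∣⁅x⁆∪p∣≤1+∣p∣ v (touched s)) (s≤s (∣touched∣≤cost s))
∣touched∣≤cost (load v ∷ s)    = ℕP.≤-trans (∣⁅x⁆∪p∣≤1+∣p∣ v (touched s)) (s≤s (∣touched∣≤cost s))
∣touched∣≤cost (compute _ ∷ s) = ∣touched∣≤cost s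
∣touched∣≤cost (evict _ ∷ s)   = ∣touched∣≤cost s

module Execution {n : ℕ} (G : Graph n) (M : ℕ) where

  open State

  data Exec : State n → List (Op n) → State n → Set where
    []  : ∀ {st} → Exec st [] st
    _∷_ : ∀ {st o st′ s st″} → Step G M st o st′ → Exec st′ s st″ → Exec st (o ∷ s) st″

  run⇒exec : ∀ {st s} → Run G M st s → ∃ (Exec st s)
  run⇒exec done          = _ , []
  run⇒exec (step st→ r) = let _ , e = run⇒exec r in _ , st→ ∷ e

  exec-++⁺ : ∀ {st s st′ t st″} → Exec st s st′ → Exec st′ t st″ → Exec st (s ++ t) st″
  exec-++⁺ []       e′ = e′
  exec-++⁺ (x ∷ e) e′ = x ∷ exec-++⁺ e e′

  exec-++⁻ : ∀ s {st t st″} → Exec st (s ++ t) st″ → ∃ λ st′ → Exec st s st′ × Exec st′ t st″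
  exec-++⁻ []      e       = _ , [] , e
  exec-++⁻ (_ ∷ s) (x ∷ e) = let st′ , eˡ , eʳ = exec-++⁻ s e in st′ , x ∷ eˡ , eʳ

  fast-bounded : ∀ {st s st′} → Exec st s st′ → ∣ fast st ∣ ℕ.≤ M → ∣ fast st′ ∣ ℕ.≤ M
  fast-bounded []                          ∣f∣≤M = ∣f∣≤M
  fast-bounded (compute _ ∣f′∣≤M ∷ e)     _     = fast-bounded e ∣f′∣≤M
  fast-bounded (store _ ∷ e)               ∣f∣≤M = fast-bounded e ∣f∣≤M
  fast-bounded (load _ ∣f′∣≤M ∷ e)        _     = fast-bounded e ∣f′∣≤M
  fast-bounded (evict {f = f} {v = v} ∷ e) ∣f∣≤M = fast-bounded e (ℕP.≤-trans (∣p─q∣≤∣p∣ f ⁅ v ⁆) ∣f∣≤M)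

  module _ {u : Fin n} where

    fresh-preserved : ∀ {st s st′} → Exec st s st′ → u ∉ₛ fast st → u ∉ₛ slow st → u ∉ computed s →
                      u ∉ₛ fast st′ × u ∉ₛ slow st′
    fresh-preserved [] u∉f u∉s _ = u∉f , u∉s
    fresh-preserved (compute _ _ ∷ e) u∉f u∉s u∉c =
      fresh-preserved e (∉∪⁺ u∉f (x≢y⇒x∉⁅y⁆ (u∉c ∘ here))) u∉s (u∉c ∘ there)
    fresh-preserved (store v∈f ∷ e) u∉f u∉s u∉c =
      fresh-preserved e u∉f (∉∪⁺ u∉s (x≢y⇒x∉⁅y⁆ λ { refl → u∉f v∈f })) u∉c
    fresh-preserved (load v∈s _ ∷ e) u∉f u∉s u∉c =
      fresh-preserved e (∉∪⁺ u∉f (x≢y⇒x∉⁅y⁆ λ { refl → u∉s v∈s })) u∉s u∉c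
    fresh-preserved (evict ∷ e) u∉f u∉s u∉c = fresh-preserved e (∉-⁺ u∉f) u∉s u∉c

    fresh⇒untouched : ∀ {st s st′} → Exec st s st′ → u ∉ₛ fast st → u ∉ₛ slow st → u ∉ computed s →
                      u ∉ₛ touched s
    fresh⇒untouched [] _ _ _ = ∉⊥
    fresh⇒untouched (compute _ _ ∷ e) u∉f u∉s u∉c =
      fresh⇒untouched e (∉∪⁺ u∉f (x≢y⇒x∉⁅y⁆ (u∉c ∘ here))) u∉s (u∉c ∘ there)
    fresh⇒untouched (store {v = v} v∈f ∷ e) u∉f u∉s u∉c =
      ∉∪⁺ u∉⁅v⁆ (fresh⇒untouched e u∉f (∉∪⁺ u∉s u∉⁅v⁆) u∉c)
      where
      u∉⁅v⁆ : u ∉ₛ ⁅ v ⁆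
      u∉⁅v⁆ = x≢y⇒x∉⁅y⁆ λ { refl → u∉f v∈f }
    fresh⇒untouched (load {v = v} v∈s _ ∷ e) u∉f u∉s u∉c =
      ∉∪⁺ u∉⁅v⁆ (fresh⇒untouched e (∉∪⁺ u∉f u∉⁅v⁆) u∉s u∉c)
      where
      u∉⁅v⁆ : u ∉ₛ ⁅ v ⁆
      u∉⁅v⁆ = x≢y⇒x∉⁅y⁆ λ { refl → u∉s v∈s }
    fresh⇒untouched (evict ∷ e) u∉f u∉s u∉c = fresh⇒untouched e (∉-⁺ u∉f) u∉s u∉c

    ∉slow-preserved : ∀ {st s st′} → Exec st s st′ → u ∉ₛ slow st → u ∉ₛ touched s → u ∉ₛ slow st′
    ∉slow-preserved []                u∉s _   = u∉s
    ∉slow-preserved (compute _ _ ∷ e) u∉s u∉t = ∉slow-preserved e u∉s u∉t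
    ∉slow-preserved (store _ ∷ e)     u∉s u∉t = ∉slow-preserved e (∉∪⁺ u∉s (∉∪⁻ˡ u∉t)) (∉∪⁻ʳ u∉t)
    ∉slow-preserved (load _ _ ∷ e)    u∉s u∉t = ∉slow-preserved e u∉s (∉∪⁻ʳ u∉t)
    ∉slow-preserved (evict ∷ e)       u∉s u∉t = ∉slow-preserved e u∉s u∉t

    operand-unavailable : ∀ {st s st′ v} → Exec st s st′ → u ∉ₛ fast st → u ∉ₛ touched s →
                          u ∉ computed s → v ∈ computed s → E G u v ≡ true → ⊥
    operand-unavailable [] _ _ _ () _
    operand-unavailable (compute parents _ ∷ _) u∉f _ _ (here refl) uv = u∉f (parents _ uv)
    operand-unavailable (compute _ _ ∷ e) u∉f u∉t u∉c (there v∈c) uv =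
      operand-unavailable e (∉∪⁺ u∉f (x≢y⇒x∉⁅y⁆ (u∉c ∘ here))) u∉t (u∉c ∘ there) v∈c uv
    operand-unavailable (store _ ∷ e) u∉f u∉t u∉c v∈c uv =
      operand-unavailable e u∉f (∉∪⁻ʳ u∉t) u∉c v∈c uv
    operand-unavailable (load _ _ ∷ e) u∉f u∉t u∉c v∈c uv =
      operand-unavailable e (∉∪⁺ u∉f (∉∪⁻ˡ u∉t)) (∉∪⁻ʳ u∉t) u∉c v∈c uv
    operand-unavailable (evict ∷ e) u∉f u∉t u∉c v∈c uv =
      operand-unavailable e (∉-⁺ u∉f) u∉t u∉c v∈c uv

  ∅-state : State n
  ∅-state = ⟨ ∅ , ∅ ⟩

  module Window {pre w post : List (Op n)} {st₁ st₂ st₃ : State n}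
                (e-pre : Exec ∅-state pre st₁) (e-w : Exec st₁ w st₂) (e-post : Exec st₂ post st₃)
                (enum : Enumerates (computed pre ++ computed w ++ computed post)) where

    crossing-source-resident : ∀ {u v} → E G u v ≡ true → Crosses (computed w) u v →
      u ∉ₛ fast st₁ → u ∉ₛ fast st₂ → u ∉ₛ touched w → ⊥
    crossing-source-resident uv (inj₂ (u∉w , v∈w)) u∉f₁ _ u∉t =
      operand-unavailable e-w u∉f₁ u∉t u∉w v∈w uv
    -- If v precedes the window, u was still unevaluated, hence never loaded, when v
    -- was evaluated; if v follows it, u was stored nowhere and held nowhere at its end.
    crossing-source-resident {u} uv (inj₁ (u∈w , v∉w)) _ u∉f₂ u∉t =
      [ (λ v∈pre → operand-unavailable e-pre ∉⊥ (fresh⇒untouched e-pre ∉⊥ ∉⊥ u∉pre) u∉pre v∈pre uv)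
      , (λ v∈post → operand-unavailable e-post u∉f₂ (fresh⇒untouched e-post u∉f₂ u∉s₂ u∉post) u∉post v∈post uv)
      ] (∉middle⇒∈outer (computed pre) enum v∉w)
      where
      u∉pre : u ∉ computed pre
      u∉pre = proj₁ (∈middle⇒∉outer (computed pre) enum u∈w)
      u∉post : u ∉ computed post
      u∉post = proj₂ (∈middle⇒∉outer (computed pre) enum u∈w)
      u∉s₂ : u ∉ₛ slow st₂
      u∉s₂ = ∉slow-preserved e-w (proj₂ (fresh-preserved e-pre ∉⊥ ∉⊥ u∉pre)) u∉t

    boundarySources⊆ : boundarySources G (computed w) ⊆ fast st₁ ∪ (fast st₂ ∪ touched w)
    boundarySources⊆ {u} u∈B with u ∈? fast st₁ | u ∈? fast st₂ | u ∈? touched w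
    ... | yes u∈f₁ | _        | _       = x∈p∪q⁺ (inj₁ u∈f₁)
    ... | no _     | yes u∈f₂ | _       = x∈p∪q⁺ (inj₂ (x∈p∪q⁺ (inj₁ u∈f₂)))
    ... | no _     | no _     | yes u∈t = x∈p∪q⁺ (inj₂ (x∈p∪q⁺ (inj₂ u∈t)))
    ... | no u∉f₁  | no u∉f₂  | no u∉t  =
      let _ , uv , crosses = ∈boundarySources⇒crossing G (computed w) u∈B
      in  ⊥-elim (crossing-source-resident uv crosses u∉f₁ u∉f₂ u∉t)

    ∣boundarySources∣≤ : ∣ boundarySources G (computed w) ∣ ℕ.≤ M ℕ.+ (M ℕ.+ cost w)
    ∣boundarySources∣≤ = begin
      ∣ boundarySources G (computed w) ∣       ≤⟨ p⊆q⇒∣p∣≤∣q∣ boundarySources⊆ ⟩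
      ∣ fast st₁ ∪ (fast st₂ ∪ touched w) ∣    ≤⟨ ∣p∪q∣≤∣p∣+∣q∣ (fast st₁) _ ⟩
      ∣ fast st₁ ∣ ℕ.+ ∣ fast st₂ ∪ touched w ∣ ≤⟨ ℕP.+-monoʳ-≤ ∣ fast st₁ ∣ (∣p∪q∣≤∣p∣+∣q∣ (fast st₂) _) ⟩
      ∣ fast st₁ ∣ ℕ.+ (∣ fast st₂ ∣ ℕ.+ ∣ touched w ∣)
        ≤⟨ ℕP.+-mono-≤ ∣f₁∣≤M (ℕP.+-mono-≤ (fast-bounded e-w ∣f₁∣≤M) (∣touched∣≤cost w)) ⟩
      M ℕ.+ (M ℕ.+ cost w) ∎
      where
      open ℕP.≤-Reasoning
      ∣f₁∣≤M : ∣ fast st₁ ∣ ℕ.≤ M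
      ∣f₁∣≤M = fast-bounded e-pre (subst (ℕ._≤ M) (sym (∣⊥∣≡0 n)) z≤n)

  open Window using (∣boundarySources∣≤)

  partition-bound : ∀ P {pre rest st st′} → Exec ∅-state pre st → Exec st rest st′ →
    computed rest ≡ concat P → Enumerates (computed pre ++ concat P) →
    sumℕ (map (λ S → ∣ boundarySources G S ∣) P) ℕ.≤ 2 ℕ.* M ℕ.* length P ℕ.+ cost rest
  partition-bound [] _ _ _ _ = z≤n
  partition-bound (S ∷ P) {pre} {rest} e-pre e-rest eq enum
    with w , r , refl , refl , r↦P ← split-computed rest S (concat P) eq
    with st₂ , e-w , e-r ← exec-++⁻ w e-rest = begin
      ∣ boundarySources G (computed w) ∣ ℕ.+ sumℕ (map (λ S → ∣ boundarySources G S ∣) P)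
        ≤⟨ ℕP.+-mono-≤ (∣boundarySources∣≤ e-pre e-w e-r enum-w)
                       (partition-bound P (exec-++⁺ e-pre e-w) e-r r↦P enum-r) ⟩
      M ℕ.+ (M ℕ.+ cost w) ℕ.+ (2 ℕ.* M ℕ.* length P ℕ.+ cost r)
        ≡⟨ regroup M (cost w) (length P) (cost r) ⟩
      2 ℕ.* M ℕ.* suc (length P) ℕ.+ (cost w ℕ.+ cost r)
        ≡⟨ cong (2 ℕ.* M ℕ.* suc (length P) ℕ.+_) (cost-++ w r) ⟨
      2 ℕ.* M ℕ.* suc (length P) ℕ.+ cost (w ++ r) ∎
    where
    open ℕP.≤-Reasoning
    regroup : ∀ m a l b → m ℕ.+ (m ℕ.+ a) ℕ.+ (2 ℕ.* m ℕ.* l ℕ.+ b) ≡ 2 ℕ.* m ℕ.* suc l ℕ.+ (a ℕ.+ b)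
    regroup = solve-∀
    enum-w : Enumerates (computed pre ++ computed w ++ computed r)
    enum-w = subst (λ xs → Enumerates (computed pre ++ computed w ++ xs)) (sym r↦P) enum
    enum-r : Enumerates (computed (pre ++ w) ++ concat P)
    enum-r = subst Enumerates
      (trans (sym (ListP.++-assoc (computed pre) (computed w) (concat P)))
             (cong (_++ concat P) (sym (computed-++ pre w))))
      enum

theorem4p2 : ∀ {n : ℕ} (G : Graph n) → Acyclic G → (M : ℕ) → OptIO≥MinMax G M
theorem4p2 {n} G _ M X order s (run , s↦X) = X , order , value≤cost
  where
  open Execution G M using (run⇒exec; partition-bound; [])

  value≤cost : ∀ P → ConsecPartition X P → partitionValue G M P ≤ ℤ.+ cost s / 1
  value≤cost P (_ , P↦X) = -+-cancel _ _ _ (begin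
    sumℚ (map (boundaryWeight G) P)
      ≤⟨ sumℚ-mono-≤ P (boundaryWeight≤∣boundarySources∣ G) ⟩
    sumℚ (map (fromℕ ∘ ∣B∣) P)
      ≡⟨ sumℚ-fromℕ ∣B∣ P ⟩
    fromℕ (sumℕ (map ∣B∣ P))
      ≤⟨ fromℕ-mono-≤ (partition-bound P [] (proj₂ (run⇒exec run)) (trans s↦X (sym P↦X)) enumerates) ⟩
    fromℕ (2M|P| ℕ.+ cost s)
      ≡⟨ fromℕ-+ 2M|P| (cost s) ⟩
    fromℕ 2M|P| + fromℕ (cost s)
      ≡⟨ cong₂ _+_ (/1≡fromℕ 2M|P|) (/1≡fromℕ (cost s)) ⟨
    ℤ.+ 2M|P| / 1 + ℤ.+ cost s / 1 ∎)
    where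
    open ℚP.≤-Reasoning
    ∣B∣ : List (Fin n) → ℕ
    ∣B∣ S = ∣ boundarySources G S ∣
    2M|P| : ℕ
    2M|P| = 2 ℕ.* M ℕ.* length P
    enumerates : Enumerates (concat P)
    enumerates = subst Enumerates (sym P↦X) (TopOrder.unique order , TopOrder.complete order)
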